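{- Let $n\ge 2$ and $x=(x_1,\ldots,x_n)^T\in\mathbb{Z}^n$ with $1\le x_i\le n$ for $i=1,\ldots,n$ and $A(n)x<>\mathbf{0}$. Then \[ x=\frac{1}{2}\left(A(n)^T\,\mathrm{sgn}(A(n)x) + (n+1)\mathbf{1}_n\right). \]
   Context: For $n\ge 1$ let $s(n)=n(n-1)/2$. The matrix $A(n)$ is the $s(n)\times n$ integer matrix whose rows are indexed by the pairs $(i,j)$ with $1\le i<j\le n$, in lexicographic order; the row for $(i,j)$ has entry $+1$ in column $i$, $-1$ in column $j$, and $0$ elsewhere. For $y\in\mathbb{Z}^s$, $y<>\mathbf{0}$ means every component of $y$ is nonzero, and then $\mathrm{sgn}(y)=(\mathrm{sgn}(y_1),\ldots,\mathrm{sgn}(y_s))^T$. $\mathbf{1}_n$ is the all-ones vector in $\mathbb{Z}^n$. -}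

module Defs where

open import Data.Nat using (ℕ; suc)
open import Data.Integer using (ℤ; +_; -[1+_]; _+_; _*_; -_; 0ℤ; 1ℤ; -1ℤ; _<_)
open import Data.Fin using (Fin; _≟_; _<?_)
open import Data.Fin.Base using (toℕ)
open import Data.List using (List; []; _∷_; concatMap; filter; allFin; length)
open import Data.List.Base using (lookup)
open import Data.Product using (_×_; _,_; proj₁; proj₂)
open import Data.Vec.Functional using (Vector; foldr)
open import Relation.Nullary using (¬_; yes; no)
open import Relation.Binary.PropositionalEquality using (_≡_)

pairs : (n : ℕ) → List (Fin n × Fin n)
pairs n = concatMap (λ i → Data.List.map (λ j → (i , j)) (filter (λ j → i <? j) (allFin n))) (allFin n)

-- s(n) = number of rows (= n(n-1)/2)
s : ℕ → ℕ
s n = length (pairs n)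

Matrix : ℕ → ℕ → Set
Matrix m k = Fin m → Fin k → ℤ

A : (n : ℕ) → Matrix (s n) n
A n r c with lookup (pairs n) r
... | (i , j) with c ≟ i | c ≟ j
...   | yes _ | _     = 1ℤ
...   | no _  | yes _ = -1ℤ
...   | no _  | no _  = 0ℤ

transpose : ∀ {m k} → Matrix m k → Matrix k m
transpose M c r = M r c

sumFin : ∀ {k} → (Fin k → ℤ) → ℤ
sumFin {k} f = foldr _+_ 0ℤ f

_·_ : ∀ {m k} → Matrix m k → Vector ℤ k → Vector ℤ m
(M · x) r = sumFin (λ c → M r c * x c)

-- y <> 0 : every component nonzero
AllNonzero : ∀ {m} → Vector ℤ m → Set
AllNonzero y = ∀ r → ¬ (y r ≡ 0ℤ)

sgnℤ : ℤ → ℤ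
sgnℤ (+ 0) = 0ℤ
sgnℤ (+ (suc _)) = 1ℤ
sgnℤ -[1+ _ ] = -1ℤ

sgn : ∀ {m} → Vector ℤ m → Vector ℤ m
sgn y r = sgnℤ (y r)

module Submission where

open import Defs
open import Data.Bool using (if_then_else_)
open import Data.Empty using (⊥-elim)
open import Data.Fin as F using (Fin; zero; suc; _<?_)
import Data.Fin.Properties as FinP
open import Data.Integer as ℤ using (ℤ; +_; 0ℤ; 1ℤ; -1ℤ; -_; _+_; _-_; _*_; pred; _<_; _≤_; _≤?_)
import Data.Integer.Properties as ℤP
open import Data.Integer.Tactic.RingSolver using (solve-∀)
open import Data.List as List using (List; []; _∷_; _++_; map; filter; tabulate; allFin; concatMap)
open import Data.List.Base using (lookup)
import Data.List.Properties as ListP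
open import Data.List.Membership.Propositional using (_∈_)
open import Data.List.Membership.Propositional.Properties
  using (∈-lookup; ∈-allFin; ∈-concatMap⁺; ∈-concatMap⁻; ∈-map⁺; ∈-map⁻; ∈-filter⁺; ∈-filter⁻)
import Data.List.Relation.Unary.Any as Any
open import Data.List.Relation.Unary.Any.Properties using (lookup-index)
open import Data.Nat as ℕ using (ℕ; _≥_)
import Data.Nat.Properties as ℕP
open import Data.Product using (_×_; _,_; proj₁; proj₂)
open import Data.Vec.Functional using (Vector)
open import Function using (_∘_; _⇔_; mk⇔; Equivalence)
open import Function.Definitions using (Injective)
open import Relation.Binary using (tri<; tri≈; tri>; DecidableEquality)
open import Relation.Binary.PropositionalEquality
  using (_≡_; _≢_; refl; sym; trans; cong; cong₂; subst; module ≡-Reasoning)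
open import Relation.Nullary using (Dec; does; yes; no; ¬_)
open import Relation.Nullary.Decidable using (dec-true; dec-false)
-- This sum is the same fold as Defs.sumFin, so the two are interchangeable definitionally.
open import Algebra.Properties.Semiring.Sum ℤP.+-*-semiring
  using (sum; sum-cong-≗; sum-replicate-zero; ∑-distrib-+; ∑-comm; *-distribˡ-sum)

-- The row of A(n) for (i , j) is e_i - e_j, so A(n)x <> 0 says exactly that the x_i are
-- pairwise distinct, and column c of A(n)^T sgn(A(n)x) collects sgn(x_c - x_k) over all k.
-- Writing N(m) = #{k | x_k ≤ m}, we have sgn(x_c - x_k) + 1 = [x_k ≤ x_c - 1] + [x_k ≤ x_c],
-- so this column equals N(x_c - 1) + N(x_c) - n. Distinctness gives N(m + 1) ≤ N(m) + 1,
-- while N(0) = 0 and N(n) = n by the range hypothesis; hence N(m) = m for 0 ≤ m ≤ n, and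
-- the column is (x_c - 1) + x_c - n = 2 x_c - (n + 1).

indicator : ∀ {p} {P : Set p} → Dec P → ℤ
indicator d = if does d then 1ℤ else 0ℤ

indicator-yes : ∀ {p} {P : Set p} (d : Dec P) → P → indicator d ≡ 1ℤ
indicator-yes d p rewrite dec-true d p = refl

indicator-no : ∀ {p} {P : Set p} (d : Dec P) → ¬ P → indicator d ≡ 0ℤ
indicator-no d ¬p rewrite dec-false d ¬p = refl

δ : ∀ {n} → Fin n → Fin n → ℤ
δ k i = indicator (k F.≟ i)

δ-sym : ∀ {n} (k i : Fin n) → δ k i ≡ δ i k
δ-sym zero    zero    = refl
δ-sym zero    (suc i) = refl
δ-sym (suc k) zero    = refl
δ-sym (suc k) (suc i) = δ-sym k i

sum-zero : ∀ {n} {f : Vector ℤ n} → (∀ k → f k ≡ 0ℤ) → sum f ≡ 0ℤ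
sum-zero {n} f≡0 = trans (sum-cong-≗ f≡0) (sum-replicate-zero n)

sum-const-1 : ∀ n → sum {n} (λ _ → 1ℤ) ≡ + n
sum-const-1 ℕ.zero    = refl
sum-const-1 (ℕ.suc n) = cong (_+_ 1ℤ) (sum-const-1 n)

∑-distrib-minus : ∀ {n} (f g : Vector ℤ n) → sum (λ k → f k - g k) ≡ sum f - sum g
∑-distrib-minus {ℕ.zero}  f g = refl
∑-distrib-minus {ℕ.suc n} f g = begin
  (f zero - g zero) + sum (λ k → f (suc k) - g (suc k))
    ≡⟨ cong (_+_ (f zero - g zero)) (∑-distrib-minus (f ∘ suc) (g ∘ suc)) ⟩
  (f zero - g zero) + (sum (f ∘ suc) - sum (g ∘ suc))
    ≡⟨ interchange (f zero) (g zero) (sum (f ∘ suc)) (sum (g ∘ suc)) ⟩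
  (f zero + sum (f ∘ suc)) - (g zero + sum (g ∘ suc))
    ∎
  where
  open ≡-Reasoning
  interchange : ∀ a b c d → (a - b) + (c - d) ≡ (a + c) - (b + d)
  interchange = solve-∀

sum-δ : ∀ {n} (i : Fin n) (f : Vector ℤ n) → sum (λ k → δ k i * f k) ≡ f i
sum-δ zero f = begin
  1ℤ * f zero + sum (λ k → 0ℤ * f (suc k))
    ≡⟨ cong₂ _+_ (ℤP.*-identityˡ (f zero)) (sum-zero {f = λ k → 0ℤ * f (suc k)} (λ _ → refl)) ⟩
  f zero + 0ℤ
    ≡⟨ ℤP.+-identityʳ (f zero) ⟩
  f zero
    ∎
  where open ≡-Reasoning
sum-δ (suc i) f = trans (ℤP.+-identityˡ _) (sum-δ i (f ∘ suc))

count : ∀ {n p} {P : Fin n → Set p} → (∀ k → Dec (P k)) → ℤ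
count P? = sum (λ k → indicator (P? k))

listSum : List ℤ → ℤ
listSum = List.foldr _+_ 0ℤ

listSum-++ : ∀ xs ys → listSum (xs ++ ys) ≡ listSum xs + listSum ys
listSum-++ []       ys = sym (ℤP.+-identityˡ (listSum ys))
listSum-++ (x ∷ xs) ys =
  trans (cong (_+_ x) (listSum-++ xs ys)) (sym (ℤP.+-assoc x (listSum xs) (listSum ys)))

listSum-concatMap : ∀ {a} {A : Set a} (f : A → List ℤ) xs →
  listSum (concatMap f xs) ≡ listSum (map (listSum ∘ f) xs)
listSum-concatMap f []       = refl
listSum-concatMap f (x ∷ xs) =
  trans (listSum-++ (f x) (concatMap f xs)) (cong (_+_ (listSum (f x))) (listSum-concatMap f xs))

listSum-filter : ∀ {a p} {A : Set a} {P : A → Set p} (P? : ∀ x → Dec (P x)) (g : A → ℤ) xs →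
  listSum (map g (filter P? xs)) ≡ listSum (map (λ x → indicator (P? x) * g x) xs)
listSum-filter P? g [] = refl
listSum-filter P? g (x ∷ xs) with P? x
... | yes _ = cong₂ _+_ (sym (ℤP.*-identityˡ (g x))) (listSum-filter P? g xs)
... | no _  = trans (listSum-filter P? g xs) (sym (ℤP.+-identityˡ _))

listSum-tabulate : ∀ {n} (f : Vector ℤ n) → listSum (tabulate f) ≡ sum f
listSum-tabulate {ℕ.zero}  f = refl
listSum-tabulate {ℕ.suc n} f = cong (_+_ (f zero)) (listSum-tabulate (f ∘ suc))

listSum-allFin : ∀ n (f : Vector ℤ n) → listSum (map f (allFin n)) ≡ sum f
listSum-allFin n f = trans (cong listSum (ListP.map-tabulate (λ i → i) f)) (listSum-tabulate f)

sum-lookup : ∀ {a} {A : Set a} (xs : List A) (g : A → ℤ) → sum (g ∘ lookup xs) ≡ listSum (map g xs)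
sum-lookup []       g = refl
sum-lookup (x ∷ xs) g = cong (_+_ (g x)) (sum-lookup xs g)

pairs-row : ∀ n → Fin n → List (Fin n × Fin n)
pairs-row n i = map (i ,_) (filter (i <?_) (allFin n))

∈-pairs : ∀ {n} {i j : Fin n} → (i , j) ∈ pairs n ⇔ i F.< j
∈-pairs {n} {i} {j} = mk⇔ to from
  where
  to : (i , j) ∈ pairs n → i F.< j
  to ij∈ with Any.satisfied (∈-concatMap⁻ (pairs-row n) {xs = allFin n} ij∈)
  ... | _ , ij∈row with _ , j∈ , refl ← ∈-map⁻ (_ ,_) ij∈row =
    proj₂ (∈-filter⁻ (_ <?_) {xs = allFin n} j∈)
  from : i F.< j → (i , j) ∈ pairs n
  from i<j = ∈-concatMap⁺ (pairs-row n)
    (Any.map (λ { refl → ∈-map⁺ (i ,_) (∈-filter⁺ (i <?_) (∈-allFin j) i<j) }) (∈-allFin i))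

pairs-ordered : ∀ n r → proj₁ (lookup (pairs n) r) F.< proj₂ (lookup (pairs n) r)
pairs-ordered n r = Equivalence.to ∈-pairs (∈-lookup {xs = pairs n} r)

sum-pairs : ∀ {n} (g : Fin n × Fin n → ℤ) →
  sum (g ∘ lookup (pairs n)) ≡ sum (λ i → sum (λ j → indicator (i <? j) * g (i , j)))
sum-pairs {n} g = begin
  sum (g ∘ lookup (pairs n))
    ≡⟨ sum-lookup (pairs n) g ⟩
  listSum (map g (pairs n))
    ≡⟨ cong listSum (ListP.map-concatMap g (pairs-row n) (allFin n)) ⟩
  listSum (concatMap (map g ∘ pairs-row n) (allFin n))
    ≡⟨ listSum-concatMap (map g ∘ pairs-row n) (allFin n) ⟩
  listSum (map (listSum ∘ map g ∘ pairs-row n) (allFin n))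
    ≡⟨ cong listSum (ListP.map-cong row-sum (allFin n)) ⟩
  listSum (map (λ i → sum (λ j → indicator (i <? j) * g (i , j))) (allFin n))
    ≡⟨ listSum-allFin n _ ⟩
  sum (λ i → sum (λ j → indicator (i <? j) * g (i , j)))
    ∎
  where
  open ≡-Reasoning
  row-sum : ∀ i → listSum (map g (pairs-row n i)) ≡ sum (λ j → indicator (i <? j) * g (i , j))
  row-sum i = begin
    listSum (map g (map (i ,_) (filter (i <?_) (allFin n))))
      ≡⟨ cong listSum (sym (ListP.map-∘ (filter (i <?_) (allFin n)))) ⟩
    listSum (map (g ∘ (i ,_)) (filter (i <?_) (allFin n)))
      ≡⟨ listSum-filter (i <?_) (g ∘ (i ,_)) (allFin n) ⟩
    listSum (map (λ j → indicator (i <? j) * g (i , j)) (allFin n))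
      ≡⟨ listSum-allFin n _ ⟩
    sum (λ j → indicator (i <? j) * g (i , j))
      ∎

neg-distrib-sgnℤ : ∀ z → sgnℤ (- z) ≡ - sgnℤ z
neg-distrib-sgnℤ (+ ℕ.zero)  = refl
neg-distrib-sgnℤ (+ ℕ.suc _) = refl
neg-distrib-sgnℤ ℤ.-[1+ _ ]  = refl

sgnℤ-antisym : ∀ a b → sgnℤ (a - b) ≡ - sgnℤ (b - a)
sgnℤ-antisym a b = trans (cong sgnℤ (flip a b)) (neg-distrib-sgnℤ (b - a))
  where
  flip : ∀ a b → a - b ≡ - (b - a)
  flip = solve-∀

sgnℤ-pos : ∀ {z} → 0ℤ < z → sgnℤ z ≡ 1ℤ
sgnℤ-pos {+ ℕ.suc _} _          = refl
sgnℤ-pos {+ ℕ.zero}  (ℤ.+<+ ())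

sgnℤ-neg : ∀ {z} → z < 0ℤ → sgnℤ z ≡ -1ℤ
sgnℤ-neg {ℤ.-[1+ _ ]} _          = refl
sgnℤ-neg {+ _}        (ℤ.+<+ ())

sgnℤ-via-indicators : ∀ v y → sgnℤ (v - y) + 1ℤ ≡ indicator (y ≤? pred v) + indicator (y ≤? v)
sgnℤ-via-indicators v y with ℤP.<-cmp y v
... | tri< y<v _ _
  rewrite sgnℤ-pos (subst (_< v - y) (ℤP.+-inverseʳ y) (ℤP.+-monoˡ-< (- y) y<v))
        | indicator-yes (y ≤? pred v) (ℤP.i<j⇒i≤pred[j] y<v)
        | indicator-yes (y ≤? v) (ℤP.<⇒≤ y<v) = refl
... | tri≈ _ refl _
  rewrite ℤP.+-inverseʳ v
        | indicator-no (v ≤? pred v) (ℤP.<-irrefl refl ∘ ℤP.i≤pred[j]⇒i<j)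
        | indicator-yes (v ≤? v) ℤP.≤-refl = refl
... | tri> _ _ v<y
  rewrite sgnℤ-neg (subst (v - y <_) (ℤP.+-inverseʳ y) (ℤP.+-monoˡ-< (- y) v<y))
        | indicator-no (y ≤? pred v) (ℤP.<-asym v<y ∘ ℤP.i≤pred[j]⇒i<j)
        | indicator-no (y ≤? v) (ℤP.<⇒≱ v<y) = refl

-- Row (i , j) contributes sgn(x_i - x_j) to column i and, by antisymmetry of the sign,
-- sgn(x_j - x_i) to column j.
incidence-sgn : ∀ {n} (x : Vector ℤ n) {i j : Fin n} c → i ≢ j →
  (δ c i - δ c j) * sgnℤ (x i - x j) ≡ δ i c * sgnℤ (x c - x j) + δ j c * sgnℤ (x c - x i)
incidence-sgn x {i} {j} c i≢j rewrite δ-sym i c | δ-sym j c with c F.≟ i | c F.≟ j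
... | yes refl | yes refl = ⊥-elim (i≢j refl)
... | yes refl | no _     = sym (ℤP.+-identityʳ _)
... | no _     | no _     = refl
... | no _     | yes refl = begin
  -1ℤ * sgnℤ (x i - x c)      ≡⟨ ℤP.-1*i≡-i _ ⟩
  - sgnℤ (x i - x c)          ≡⟨ sym (sgnℤ-antisym (x c) (x i)) ⟩
  sgnℤ (x c - x i)            ≡⟨ sym (ℤP.*-identityˡ _) ⟩
  1ℤ * sgnℤ (x c - x i)       ≡⟨ sym (ℤP.+-identityˡ _) ⟩
  0ℤ + 1ℤ * sgnℤ (x c - x i)  ∎
  where open ≡-Reasoning

sum-incident-pairs : ∀ {n} (c : Fin n) (φ : Vector ℤ n) → φ c ≡ 0ℤ →
  sum (λ i → sum (λ j → indicator (i <? j) * (δ i c * φ j + δ j c * φ i))) ≡ sum φ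
sum-incident-pairs {n} c φ φc≡0 = begin
  sum (λ i → sum (λ j → indicator (i <? j) * (δ i c * φ j + δ j c * φ i)))
    ≡⟨ sum-cong-≗ (λ i → trans (sum-cong-≗ (λ j → regroup (indicator (i <? j)) (δ i c) (φ j) (δ j c) (φ i)))
                              (∑-distrib-+ (λ j → δ i c * after i j) (λ j → δ j c * before j i))) ⟩
  sum (λ i → sum (λ j → δ i c * after i j) + sum (λ j → δ j c * before j i))
    ≡⟨ ∑-distrib-+ (λ i → sum (λ j → δ i c * after i j)) (λ i → sum (λ j → δ j c * before j i)) ⟩
  sum (λ i → sum (λ j → δ i c * after i j)) + sum (λ i → sum (λ j → δ j c * before j i))
    ≡⟨ cong₂ _+_ (pick after) (trans (∑-comm (λ i j → δ j c * before j i)) (pick before)) ⟩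
  sum (after c) + sum (before c)
    ≡⟨ sym (∑-distrib-+ (after c) (before c)) ⟩
  sum (λ k → after c k + before c k)
    ≡⟨ sum-cong-≗ split ⟩
  sum φ
    ∎
  where
  open ≡-Reasoning
  after before : Fin n → Fin n → ℤ
  after  i j = indicator (i <? j) * φ j
  before i j = indicator (j <? i) * φ j
  regroup : ∀ e a u b v → e * (a * u + b * v) ≡ a * (e * u) + b * (e * v)
  regroup = solve-∀
  pick : ∀ (h : Fin n → Fin n → ℤ) → sum (λ i → sum (λ j → δ i c * h i j)) ≡ sum (h c)
  pick h = trans (sum-cong-≗ (λ i → sym (*-distribˡ-sum (δ i c) (h i)))) (sum-δ c (λ i → sum (h i)))
  split : ∀ k → after c k + before c k ≡ φ k
  split k with FinP.<-cmp c k
  ... | tri< c<k _ c≯k rewrite indicator-yes (c <? k) c<k | indicator-no (k <? c) c≯k =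
    trans (ℤP.+-identityʳ _) (ℤP.*-identityˡ (φ k))
  ... | tri≈ c≮k refl _ rewrite indicator-no (c <? c) c≮k = sym φc≡0
  ... | tri> c≮k _ k<c rewrite indicator-no (c <? k) c≮k | indicator-yes (k <? c) k<c =
    trans (ℤP.+-identityˡ _) (ℤP.*-identityˡ (φ k))

A-entry : ∀ n r c → A n r c ≡ δ c (proj₁ (lookup (pairs n) r)) - δ c (proj₂ (lookup (pairs n) r))
A-entry n r c with lookup (pairs n) r | pairs-ordered n r
... | (i , j) | i<j with c F.≟ i | c F.≟ j
...   | yes refl | yes refl = ⊥-elim (FinP.<-irrefl refl i<j)
...   | yes _    | no _     = refl
...   | no _     | yes _    = refl
...   | no _     | no _     = refl

A·-row : ∀ n (x : Vector ℤ n) r →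
  (A n · x) r ≡ x (proj₁ (lookup (pairs n) r)) - x (proj₂ (lookup (pairs n) r))
A·-row n x r = begin
  sum (λ c → A n r c * x c)                          ≡⟨ sum-cong-≗ entry ⟩
  sum (λ c → δ c i * x c - δ c j * x c)              ≡⟨ ∑-distrib-minus (λ c → δ c i * x c) (λ c → δ c j * x c) ⟩
  sum (λ c → δ c i * x c) - sum (λ c → δ c j * x c)  ≡⟨ cong₂ _-_ (sum-δ i x) (sum-δ j x) ⟩
  x i - x j                                          ∎
  where
  open ≡-Reasoning
  i j : Fin n
  i = proj₁ (lookup (pairs n) r)
  j = proj₂ (lookup (pairs n) r)
  distrib : ∀ a b y → (a - b) * y ≡ a * y - b * y
  distrib = solve-∀
  entry : ∀ c → A n r c * x c ≡ δ c i * x c - δ c j * x c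
  entry c = trans (cong (_* x c) (A-entry n r c)) (distrib (δ c i) (δ c j) (x c))

A-column : ∀ n (x : Vector ℤ n) c → (transpose (A n) · sgn (A n · x)) c ≡ sum (λ k → sgnℤ (x c - x k))
A-column n x c = begin
  sum (λ r → A n r c * sgnℤ ((A n · x) r))                ≡⟨ sum-cong-≗ entry ⟩
  sum (g ∘ lookup (pairs n))                              ≡⟨ sum-pairs g ⟩
  sum (λ i → sum (λ j → indicator (i <? j) * g (i , j)))  ≡⟨ sum-incident-pairs c φ φc≡0 ⟩
  sum φ                                                   ∎
  where
  open ≡-Reasoning
  φ : Vector ℤ n
  φ k = sgnℤ (x c - x k)
  φc≡0 : φ c ≡ 0ℤ
  φc≡0 = cong sgnℤ (ℤP.+-inverseʳ (x c))
  g : Fin n × Fin n → ℤ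
  g (i , j) = δ i c * φ j + δ j c * φ i
  entry : ∀ r → A n r c * sgnℤ ((A n · x) r) ≡ g (lookup (pairs n) r)
  entry r = begin
    A n r c * sgnℤ ((A n · x) r)        ≡⟨ cong₂ (λ a y → a * sgnℤ y) (A-entry n r c) (A·-row n x r) ⟩
    (δ c i - δ c j) * sgnℤ (x i - x j)  ≡⟨ incidence-sgn x c (FinP.<⇒≢ (pairs-ordered n r)) ⟩
    g (i , j)                           ∎
    where
    i j : Fin n
    i = proj₁ (lookup (pairs n) r)
    j = proj₂ (lookup (pairs n) r)

A·-nonzero⇒distinct : ∀ n (x : Vector ℤ n) → AllNonzero (A n · x) → ∀ {i j} → i F.< j → x i ≢ x j
A·-nonzero⇒distinct n x nonzero {i} {j} i<j xi≡xj = nonzero r (begin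
  (A n · x) r
    ≡⟨ A·-row n x r ⟩
  x (proj₁ (lookup (pairs n) r)) - x (proj₂ (lookup (pairs n) r))
    ≡⟨ cong (λ p → x (proj₁ p) - x (proj₂ p)) (sym (lookup-index ij∈)) ⟩
  x i - x j
    ≡⟨ cong (_- x j) xi≡xj ⟩
  x j - x j
    ≡⟨ ℤP.+-inverseʳ (x j) ⟩
  0ℤ
    ∎)
  where
  open ≡-Reasoning
  ij∈ : (i , j) ∈ pairs n
  ij∈ = Equivalence.from ∈-pairs i<j
  r : Fin (s n)
  r = Any.index ij∈

A·-nonzero⇒injective : ∀ n (x : Vector ℤ n) → AllNonzero (A n · x) → Injective _≡_ _≡_ x
A·-nonzero⇒injective n x nonzero {i} {j} xi≡xj with FinP.<-cmp i j
... | tri< i<j _ _ = ⊥-elim (A·-nonzero⇒distinct n x nonzero i<j xi≡xj)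
... | tri≈ _ i≡j _ = i≡j
... | tri> _ _ j<i = ⊥-elim (A·-nonzero⇒distinct n x nonzero j<i (sym xi≡xj))

injective⇒count-≟-≤1 : ∀ {a n} {X : Set a} (_≟_ : DecidableEquality X) (f : Fin n → X) →
  Injective _≡_ _≡_ f → ∀ y → count (λ k → f k ≟ y) ≤ 1ℤ
injective⇒count-≟-≤1 {n = ℕ.zero}  _   _ _   _ = ℤ.+≤+ ℕ.z≤n
injective⇒count-≟-≤1 {n = ℕ.suc n} _≟_ f inj y with f zero ≟ y
... | yes refl = ℤP.≤-reflexive (cong (_+_ 1ℤ) (sum-zero others-miss))
  where
  others-miss : ∀ k → indicator (f (suc k) ≟ f zero) ≡ 0ℤ
  others-miss k = indicator-no (f (suc k) ≟ f zero) (λ e → FinP.0≢1+n (sym (inj e)))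
... | no _ = subst (_≤ 1ℤ) (sym (ℤP.+-identityˡ _))
                   (injective⇒count-≟-≤1 _≟_ (f ∘ suc) (FinP.suc-injective ∘ inj) y)

+-cancelˡ-≤ : ∀ i {j k} → i + j ≤ i + k → j ≤ k
+-cancelˡ-≤ i {j} {k} i+j≤i+k = begin
  j              ≡⟨ sym (cancel i j) ⟩
  - i + (i + j)  ≤⟨ ℤP.+-monoʳ-≤ (- i) i+j≤i+k ⟩
  - i + (i + k)  ≡⟨ cancel i k ⟩
  k              ∎
  where
  open ℤP.≤-Reasoning
  cancel : ∀ a b → - a + (a + b) ≡ b
  cancel = solve-∀

indicator-≤-suc : ∀ y m → indicator (y ≤? ℤ.suc m) ≡ indicator (y ≤? m) + indicator (y ℤ.≟ ℤ.suc m)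
indicator-≤-suc y m with ℤP.<-cmp y (ℤ.suc m)
... | tri< y<1+m y≢1+m _
  rewrite indicator-yes (y ≤? ℤ.suc m) (ℤP.<⇒≤ y<1+m)
        | indicator-yes (y ≤? m) (subst (y ≤_) (ℤP.pred-suc m) (ℤP.i<j⇒i≤pred[j] y<1+m))
        | indicator-no (y ℤ.≟ ℤ.suc m) y≢1+m = refl
... | tri≈ _ refl _
  rewrite indicator-yes (ℤ.suc m ≤? ℤ.suc m) ℤP.≤-refl
        | indicator-no (ℤ.suc m ≤? m) (ℤP.<-irrefl refl ∘ ℤP.suc[i]≤j⇒i<j)
        | indicator-yes (ℤ.suc m ℤ.≟ ℤ.suc m) refl = refl
... | tri> _ y≢1+m 1+m<y
  rewrite indicator-no (y ≤? ℤ.suc m) (ℤP.<⇒≱ 1+m<y)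
        | indicator-no (y ≤? m) (ℤP.<⇒≱ 1+m<y ∘ ℤP.i≤j⇒i≤1+j)
        | indicator-no (y ℤ.≟ ℤ.suc m) y≢1+m = refl

countAtMost : ∀ {n} → Vector ℤ n → ℤ → ℤ
countAtMost x m = count (λ k → x k ≤? m)

countAtMost-suc : ∀ {n} (x : Vector ℤ n) m →
  countAtMost x (ℤ.suc m) ≡ countAtMost x m + count (λ k → x k ℤ.≟ ℤ.suc m)
countAtMost-suc x m = trans (sum-cong-≗ (λ k → indicator-≤-suc (x k) m))
  (∑-distrib-+ (λ k → indicator (x k ≤? m)) (λ k → indicator (x k ℤ.≟ ℤ.suc m)))

countAtMost-+ : ∀ {n} (x : Vector ℤ n) → Injective _≡_ _≡_ x →
  ∀ d m → countAtMost x (+ d + m) ≤ + d + countAtMost x m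
countAtMost-+ x inj ℕ.zero m rewrite ℤP.+-identityˡ m | ℤP.+-identityˡ (countAtMost x m) = ℤP.≤-refl
countAtMost-+ x inj (ℕ.suc d) m rewrite ℤP.suc-+ d m = begin
  countAtMost x (ℤ.suc (+ d + m))
    ≡⟨ countAtMost-suc x (+ d + m) ⟩
  countAtMost x (+ d + m) + count (λ k → x k ℤ.≟ ℤ.suc (+ d + m))
    ≤⟨ ℤP.+-mono-≤ (countAtMost-+ x inj d m) (injective⇒count-≟-≤1 ℤ._≟_ x inj _) ⟩
  (+ d + countAtMost x m) + 1ℤ
    ≡⟨ shift (+ d) (countAtMost x m) ⟩
  + ℕ.suc d + countAtMost x m
    ∎
  where
  open ℤP.≤-Reasoning
  shift : ∀ a b → (a + b) + 1ℤ ≡ (1ℤ + a) + b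
  shift = solve-∀

injective⇒countAtMost : ∀ {n} (x : Vector ℤ n) → Injective _≡_ _≡_ x →
  (∀ k → + 1 ≤ x k) → (∀ k → x k ≤ + n) → ∀ m → m ℕ.≤ n → countAtMost x (+ m) ≡ + m
injective⇒countAtMost {n} x inj lo hi m m≤n = ℤP.≤-antisym upper lower
  where
  open ℤP.≤-Reasoning
  none≤0 : countAtMost x 0ℤ ≡ 0ℤ
  none≤0 = sum-zero (λ k → indicator-no (x k ≤? 0ℤ) (ℤP.<⇒≱ (ℤ.+<+ ℕ.z<s) ∘ ℤP.≤-trans (lo k)))
  all≤n : countAtMost x (+ n) ≡ + n
  all≤n = trans (sum-cong-≗ (λ k → indicator-yes (x k ≤? + n) (hi k))) (sum-const-1 n)
  n-m+m : + (n ℕ.∸ m) + + m ≡ + n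
  n-m+m = cong +_ (ℕP.m∸n+n≡m m≤n)
  upper : countAtMost x (+ m) ≤ + m
  upper = begin
    countAtMost x (+ m)       ≡⟨ cong (countAtMost x) (sym (ℤP.+-identityʳ (+ m))) ⟩
    countAtMost x (+ m + 0ℤ)  ≤⟨ countAtMost-+ x inj m 0ℤ ⟩
    + m + countAtMost x 0ℤ    ≡⟨ trans (cong (_+_ (+ m)) none≤0) (ℤP.+-identityʳ (+ m)) ⟩
    + m                       ∎
  lower : + m ≤ countAtMost x (+ m)
  lower = +-cancelˡ-≤ (+ (n ℕ.∸ m)) (begin
    + (n ℕ.∸ m) + + m                  ≡⟨ trans n-m+m (sym all≤n) ⟩
    countAtMost x (+ n)                ≡⟨ cong (countAtMost x) (sym n-m+m) ⟩
    countAtMost x (+ (n ℕ.∸ m) + + m)  ≤⟨ countAtMost-+ x inj (n ℕ.∸ m) (+ m) ⟩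
    + (n ℕ.∸ m) + countAtMost x (+ m)  ∎)

sum-sgnℤ : ∀ {n} (x : Vector ℤ n) v →
  sum (λ k → sgnℤ (v - x k)) + + n ≡ countAtMost x (pred v) + countAtMost x v
sum-sgnℤ {n} x v = begin
  sum φ + + n
    ≡⟨ cong (_+_ (sum φ)) (sym (sum-const-1 n)) ⟩
  sum φ + sum {n} (λ _ → 1ℤ)
    ≡⟨ sym (∑-distrib-+ φ (λ _ → 1ℤ)) ⟩
  sum (λ k → φ k + 1ℤ)
    ≡⟨ sum-cong-≗ (λ k → sgnℤ-via-indicators v (x k)) ⟩
  sum (λ k → indicator (x k ≤? pred v) + indicator (x k ≤? v))
    ≡⟨ ∑-distrib-+ (λ k → indicator (x k ≤? pred v)) (λ k → indicator (x k ≤? v)) ⟩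
  countAtMost x (pred v) + countAtMost x v
    ∎
  where
  open ≡-Reasoning
  φ : Vector ℤ n
  φ k = sgnℤ (v - x k)

injective⇒sum-sgnℤ : ∀ {n} (x : Vector ℤ n) → Injective _≡_ _≡_ x →
  (∀ k → + 1 ≤ x k) → (∀ k → x k ≤ + n) →
  ∀ c → + 2 * x c ≡ sum (λ k → sgnℤ (x c - x k)) + (+ n + + 1)
injective⇒sum-sgnℤ {n} x inj lo hi c with x c | lo c | hi c
... | + ℕ.suc p | _ | ℤ.+≤+ 1+p≤n = begin
  + 2 * + ℕ.suc p
    ≡⟨ double (+ p) ⟩
  (+ p + + ℕ.suc p) + 1ℤ
    ≡⟨ cong (_+ 1ℤ) (sym (cong₂ _+_ (exact p (ℕP.<⇒≤ 1+p≤n)) (exact (ℕ.suc p) 1+p≤n))) ⟩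
  (countAtMost x (+ p) + countAtMost x (+ ℕ.suc p)) + 1ℤ
    ≡⟨ cong (_+ 1ℤ) (sym (sum-sgnℤ x (+ ℕ.suc p))) ⟩
  (Σsgn + + n) + 1ℤ
    ≡⟨ ℤP.+-assoc Σsgn (+ n) 1ℤ ⟩
  Σsgn + (+ n + 1ℤ)
    ∎
  where
  open ≡-Reasoning
  Σsgn : ℤ
  Σsgn = sum (λ k → sgnℤ (+ ℕ.suc p - x k))
  exact : ∀ m → m ℕ.≤ n → countAtMost x (+ m) ≡ + m
  exact = injective⇒countAtMost x inj lo hi
  double : ∀ a → + 2 * (1ℤ + a) ≡ (a + (1ℤ + a)) + 1ℤ
  double = solve-∀
... | + ℕ.zero   | ℤ.+≤+ () | _
... | ℤ.-[1+ _ ] | ()       | _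

lemma7 : (n : ℕ) → n ≥ 2 → (x : Vector ℤ n) →
    (∀ i → + 1 ≤ x i) → (∀ i → x i ≤ + n) →
    AllNonzero (A n · x) →
    ∀ i → + 2 * x i ≡ (transpose (A n) · sgn (A n · x)) i + (+ n + + 1)
lemma7 n _ x lo hi nonzero c = begin
  + 2 * x c
    ≡⟨ injective⇒sum-sgnℤ x (A·-nonzero⇒injective n x nonzero) lo hi c ⟩
  sum (λ k → sgnℤ (x c - x k)) + (+ n + + 1)
    ≡⟨ cong (_+ (+ n + + 1)) (sym (A-column n x c)) ⟩
  (transpose (A n) · sgn (A n · x)) c + (+ n + + 1)
    ∎
  where open ≡-Reasoning
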